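{- Let $G$ be a finite properly edge-colored graph with minimum degree $\delta(G)\ge 1$. Then there exists a properly edge-colored graph $G'$ such that: (1) $|V(G)|\le |V(G')|\le 4e(G)/\delta(G)$ and every vertex of $G'$ has degree between $\delta(G)/2$ and $\delta(G)$; (2) there is a color-preserving homomorphism $\psi$ from $G'$ to $G$; in particular, if $G'$ contains a rainbow cycle, then so does $G$.
   Context: A proper edge-coloring assigns different colors to edges sharing a vertex; a subgraph is rainbow if its edges have distinct colors. A homomorphism $\psi:G'\to G$ is a map $V(G')\to V(G)$ sending edges to edges; it is color-preserving if for each edge $uv$ of $G'$ the edge $\psi(u)\psi(v)$ of $G$ has the same color as $uv$. $e(G)$ is the number of edges of $G$. -}

module Defs where

open import Data.Nat using (ℕ; _≤_; _<_)
open import Data.Fin using (Fin; toℕ)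
open import Data.Fin.Properties using () renaming (_<?_ to _<ᶠ?_)
open import Data.List using (List; length; filter; allFin; concatMap; map)
open import Data.Maybe using (Maybe; just; nothing; is-just)
open import Data.Bool using (Bool; true; false; T)
open import Data.Product using (Σ; _×_; _,_; ∃)
open import Relation.Binary.PropositionalEquality using (_≡_)
open import Relation.Nullary using (¬_)
open import Relation.Nullary.Decidable using (does)
open import Data.Bool.Properties using (T?)

-- A finite (simple) edge-coloured graph with colours in C on vertex set Fin n.
-- colour u v ≡ just c  means  uv is an edge with colour c;
-- colour u v ≡ nothing means  uv is not an edge.
record ColouredGraph (C : Set) (n : ℕ) : Set where
  field
    colour    : Fin n → Fin n → Maybe C
    symmetric : ∀ u v → colour u v ≡ colour v u
    loopless  : ∀ v → colour v v ≡ nothing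
open ColouredGraph public

Proper : {C : Set} {n : ℕ} → ColouredGraph C n → Set
Proper {C} {n} G = ∀ (u v w : Fin n) (c : C) →
  colour G u v ≡ just c → colour G u w ≡ just c → v ≡ w

Adj : {C : Set} {n : ℕ} → ColouredGraph C n → Fin n → Fin n → Bool
Adj G u v = is-just (colour G u v)

degree : {C : Set} {n : ℕ} → ColouredGraph C n → Fin n → ℕ
degree {n = n} G v = length (filter (λ w → T? (Adj G v w)) (allFin n))

edgeCount : {C : Set} {n : ℕ} → ColouredGraph C n → ℕ
edgeCount {n = n} G =
  length (concatMap (λ u → filter (λ v → T? (Adj G u v))
                                  (filter (λ v → u <ᶠ? v) (allFin n)))
                    (allFin n))

IsMinDegree : {C : Set} {n : ℕ} → ColouredGraph C n → ℕ → Set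
IsMinDegree {n = n} G δ = (∀ v → δ ≤ degree G v) × ∃ λ v → degree G v ≡ δ

ColourPreservingHom : {C : Set} {m n : ℕ} → ColouredGraph C m → ColouredGraph C n →
                      (Fin m → Fin n) → Set
ColourPreservingHom {C} {m} G' G ψ =
  ∀ (u v : Fin m) (c : C) → colour G' u v ≡ just c → colour G (ψ u) (ψ v) ≡ just c

{-# OPTIONS --safe #-}
-- Put h = ⌈δ/2⌉ and replace every vertex v of degree d(v) by ⌊d(v)/h⌋ ≥ 1 copies. List the
-- neighbours of v in increasing order and cut the list into consecutive blocks, all of length h
-- except the last one, of length h + (d(v) mod h) < 2h; the j-th copy of v is responsible for the
-- j-th block. Copies (v, j) and (w, k) are joined, with the colour of vw, exactly when w lies in
-- block j of v and v lies in block k of w. Forgetting the copy index is a colour-preserving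
-- homomorphism. The new colouring is proper because a colour at v determines the neighbour w, and
-- w determines the copy of w that is used. A copy has exactly the size of its block as degree, so
-- between h and 2h − 1, and there are at most Σ d(v)/h = 2e(G)/h ≤ 4e(G)/δ copies.
module Submission where

open import Defs
open import Data.Nat using (ℕ; zero; suc; _+_; _*_; _∸_; _≤_; _<_; z≤n; s≤s; pred; NonZero; >-nonZero; _≡ᵇ_; ⌊_/2⌋; ⌈_/2⌉)
open import Data.Nat.Properties
open import Data.Nat.DivMod using (_/_; _%_; m≡m%n+[m/n]*n; m%n<n; m/n*n≤m; m≥n⇒m/n>0)
open import Data.Fin using (Fin; zero; suc; toℕ; splitAt; _↑ˡ_; _↑ʳ_)
open import Data.Fin.Properties using (toℕ-injective; toℕ<n; splitAt⁻¹-↑ˡ; splitAt⁻¹-↑ʳ) renaming (_<?_ to _<ᶠ?_)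
open import Data.List using (List; []; _∷_; length; filter; tabulate; concatMap; allFin)
open import Data.List.Properties using (length-++)
open import Data.Bool using (Bool; true; false; T; _∧_; if_then_else_)
open import Data.Bool.Properties using (∧-comm; if-eta; T-∧)
open import Data.Maybe using (Maybe; just; nothing; is-just)
open import Data.Product using (Σ; _×_; _,_; proj₁; proj₂)
import Data.Product as Σ
open import Data.Sum using (_⊎_; inj₁; inj₂; [_,_]; map₁)
open import Data.Empty using (⊥-elim)
open import Function using (_∘_; id)
open import Function.Bundles using (Equivalence)
open import Relation.Nullary using (yes; no; does)
open import Relation.Nullary.Decidable using (T?; dec-true; dec-false)
open import Relation.Unary using (Decidable)
open import Relation.Binary.PropositionalEquality using (_≡_; refl; sym; trans; cong; cong₂; subst; module ≡-Reasoning)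
open import Algebra.Properties.CommutativeMonoid.Sum +-0-commutativeMonoid
  using (sum; sum-cong-≗; sum-replicate-zero; ∑-distrib-+; ∑-comm)
open import Algebra.Properties.Semiring.Sum +-*-semiring using (*-distribʳ-sum)

𝟙 : Bool → ℕ
𝟙 true = 1
𝟙 false = 0

𝟙-∧ : ∀ a b → 𝟙 (a ∧ b) ≡ 𝟙 a * 𝟙 b
𝟙-∧ true true = refl
𝟙-∧ true false = refl
𝟙-∧ false b = refl

if-nothing≡just : ∀ {A : Set} b {x : Maybe A} {c} → (if b then x else nothing) ≡ just c → T b × x ≡ just c
if-nothing≡just true eq = _ , eq

𝟙-is-just-if-∧ : ∀ {A : Set} a b (x : Maybe A) →
  𝟙 (is-just (if a ∧ b then x else nothing)) ≡ 𝟙 b * 𝟙 (is-just x ∧ a)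
𝟙-is-just-if-∧ true true (just _) = refl
𝟙-is-just-if-∧ true true nothing = refl
𝟙-is-just-if-∧ true false (just _) = refl
𝟙-is-just-if-∧ true false nothing = refl
𝟙-is-just-if-∧ false b (just _) = sym (*-zeroʳ (𝟙 b))
𝟙-is-just-if-∧ false b nothing = sym (*-zeroʳ (𝟙 b))

∑-mono-≤ : ∀ {n} {f g : Fin n → ℕ} → (∀ i → f i ≤ g i) → sum f ≤ sum g
∑-mono-≤ {zero} f≤g = z≤n
∑-mono-≤ {suc n} f≤g = +-mono-≤ (f≤g zero) (∑-mono-≤ (f≤g ∘ suc))

n≤∑-positive : ∀ {n} (f : Fin n → ℕ) → (∀ i → 1 ≤ f i) → n ≤ sum f
n≤∑-positive {zero} f pos = z≤n
n≤∑-positive {suc n} f pos = +-mono-≤ (pos zero) (n≤∑-positive (f ∘ suc) (pos ∘ suc))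

∑-𝟙-≡ᵇ-toℕ : ∀ {q} g → g < q → sum (λ (k : Fin q) → 𝟙 (g ≡ᵇ toℕ k)) ≡ 1
∑-𝟙-≡ᵇ-toℕ {suc q} zero _ = cong suc (sum-replicate-zero q)
∑-𝟙-≡ᵇ-toℕ {suc q} (suc g) (s≤s g<q) = ∑-𝟙-≡ᵇ-toℕ g g<q

∑-splitAt : ∀ a {b} (f : Fin a ⊎ Fin b → ℕ) → sum (f ∘ splitAt a) ≡ sum (f ∘ inj₁) + sum (f ∘ inj₂)
∑-splitAt zero f = refl
∑-splitAt (suc a) f = trans (cong (f (inj₁ zero) +_) (∑-splitAt a (f ∘ map₁ suc)))
  (sym (+-assoc (f (inj₁ zero)) _ _))

unpair : ∀ {n} (q : Fin n → ℕ) → Fin (sum q) → Σ (Fin n) (Fin ∘ q)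
unpair {suc n} q x = [ (zero ,_) , Σ.map suc id ∘ unpair (q ∘ suc) ] (splitAt (q zero) x)

pair : ∀ {n} (q : Fin n → ℕ) → Σ (Fin n) (Fin ∘ q) → Fin (sum q)
pair {suc n} q (zero , j) = j ↑ˡ sum (q ∘ suc)
pair {suc n} q (suc v , j) = q zero ↑ʳ pair (q ∘ suc) (v , j)

pair-unpair : ∀ {n} (q : Fin n → ℕ) x → pair q (unpair q x) ≡ x
pair-unpair {suc n} q x with splitAt (q zero) x in eq
... | inj₁ j = splitAt⁻¹-↑ˡ eq
... | inj₂ y = trans (cong (q zero ↑ʳ_) (pair-unpair (q ∘ suc) y)) (splitAt⁻¹-↑ʳ eq)

unpair-injective : ∀ {n} (q : Fin n → ℕ) {x y} → unpair q x ≡ unpair q y → x ≡ y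
unpair-injective q {x} {y} eq =
  trans (sym (pair-unpair q x)) (trans (cong (pair q) eq) (pair-unpair q y))

∑-unpair : ∀ {n} (q : Fin n → ℕ) (f : Σ (Fin n) (Fin ∘ q) → ℕ) →
  sum (f ∘ unpair q) ≡ sum (λ v → sum (λ j → f (v , j)))
∑-unpair {zero} q f = refl
∑-unpair {suc n} q f = trans (∑-splitAt (q zero) (f ∘ [ (zero ,_) , Σ.map suc id ∘ unpair (q ∘ suc) ]))
  (cong (sum (λ j → f (zero , j)) +_) (∑-unpair (q ∘ suc) (f ∘ Σ.map suc id)))

sumBelow : ℕ → (ℕ → ℕ) → ℕ
sumBelow zero f = 0
sumBelow (suc d) f = f 0 + sumBelow d (f ∘ suc)

sumBelow-cong : ∀ d {f g : ℕ → ℕ} → (∀ r → r < d → f r ≡ g r) → sumBelow d f ≡ sumBelow d g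
sumBelow-cong zero f≡g = refl
sumBelow-cong (suc d) f≡g = cong₂ _+_ (f≡g 0 (s≤s z≤n)) (sumBelow-cong d (λ r r<d → f≡g (suc r) (s≤s r<d)))

sumBelow-+ : ∀ a b f → sumBelow (a + b) f ≡ sumBelow a f + sumBelow b (f ∘ (a +_))
sumBelow-+ zero b f = refl
sumBelow-+ (suc a) b f = trans (cong (f 0 +_) (sumBelow-+ a b (f ∘ suc))) (sym (+-assoc (f 0) _ _))

sumBelow-const : ∀ d c → sumBelow d (λ _ → c) ≡ d * c
sumBelow-const zero c = refl
sumBelow-const (suc d) c = cong (c +_) (sumBelow-const d c)

rank : ∀ {n} → (Fin n → Bool) → Fin n → ℕ
rank b zero = 0
rank b (suc w) = 𝟙 (b zero) + rank (b ∘ suc) w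

-- The ranks of the elements satisfying b are exactly 0, 1, …, (their number) − 1.
∑-rank : ∀ {n} (b : Fin n → Bool) (p : ℕ → ℕ) →
  sum (λ w → 𝟙 (b w) * p (rank b w)) ≡ sumBelow (sum (𝟙 ∘ b)) p
∑-rank {zero} b p = refl
∑-rank {suc n} b p with b zero
... | true = cong₂ _+_ (+-identityʳ (p 0)) (∑-rank (b ∘ suc) (p ∘ suc))
... | false = ∑-rank (b ∘ suc) p

-- The positions 0, 1, 2, … are cut into k blocks of length h followed by a last block holding all
-- remaining positions; block h k r is the index of the block containing r.
block : ℕ → ℕ → ℕ → ℕ
block h zero r = 0
block h (suc k) r = if does (r <? h) then 0 else suc (block h k (r ∸ h))

block-≤ : ∀ h k r → block h k r ≤ k
block-≤ h zero r = z≤n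
block-≤ h (suc k) r with does (r <? h)
... | true = z≤n
... | false = s≤s (block-≤ h k (r ∸ h))

blockSize : ℕ → ℕ → ℕ → ℕ → ℕ
blockSize h k j d = sumBelow d (λ r → 𝟙 (block h k r ≡ᵇ j))

blockSize-suc : ∀ h k j d → blockSize h (suc k) j (suc k * h + d) ≡
  h * 𝟙 (0 ≡ᵇ j) + sumBelow (k * h + d) (λ r → 𝟙 (suc (block h k r) ≡ᵇ j))
blockSize-suc h k j d = begin
  blockSize h (suc k) j (h + k * h + d)
    ≡⟨ cong (λ e → blockSize h (suc k) j e) (+-assoc h (k * h) d) ⟩
  sumBelow (h + (k * h + d)) f
    ≡⟨ sumBelow-+ h (k * h + d) f ⟩
  sumBelow h f + sumBelow (k * h + d) (f ∘ (h +_))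
    ≡⟨ cong₂ _+_ (trans (sumBelow-cong h first-block) (sumBelow-const h _))
                 (sumBelow-cong (k * h + d) (λ r _ → cong (λ b → 𝟙 (b ≡ᵇ j)) (later-blocks r))) ⟩
  h * 𝟙 (0 ≡ᵇ j) + sumBelow (k * h + d) (λ r → 𝟙 (suc (block h k r) ≡ᵇ j)) ∎
  where
  open ≡-Reasoning
  f : ℕ → ℕ
  f r = 𝟙 (block h (suc k) r ≡ᵇ j)
  first-block : ∀ r → r < h → f r ≡ 𝟙 (0 ≡ᵇ j)
  first-block r r<h rewrite dec-true (r <? h) r<h = refl
  later-blocks : ∀ r → block h (suc k) (h + r) ≡ suc (block h k r)
  later-blocks r rewrite dec-false (h + r <? h) (m+n≮m h r) | m+n∸m≡n h r = refl

blockSize-bounds : ∀ h rem k j → j ≤ k →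
  h ≤ blockSize h k j (k * h + (h + rem)) × blockSize h k j (k * h + (h + rem)) ≤ h + rem
blockSize-bounds h rem zero zero z≤n = subst (λ c → h ≤ c × c ≤ h + rem) (sym whole) (m≤m+n h rem , ≤-refl)
  where
  whole : blockSize h 0 0 (h + rem) ≡ h + rem
  whole = trans (sumBelow-const (h + rem) 1) (*-identityʳ (h + rem))
blockSize-bounds h rem (suc k) zero z≤n rewrite blockSize-suc h k 0 (h + rem)
  | *-identityʳ h | sumBelow-const (k * h + (h + rem)) 0 | *-zeroʳ (k * h + (h + rem)) | +-identityʳ h
  = ≤-refl , m≤m+n h rem
blockSize-bounds h rem (suc k) (suc j) (s≤s j≤k) rewrite blockSize-suc h k (suc j) (h + rem) | *-zeroʳ h
  = blockSize-bounds h rem k j j≤k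

length-filter-tabulate : ∀ {A : Set} {n} (b : A → Bool) (f : Fin n → A) →
  length (filter (λ x → T? (b x)) (tabulate f)) ≡ sum (λ i → 𝟙 (b (f i)))
length-filter-tabulate {n = zero} b f = refl
length-filter-tabulate {n = suc n} b f with b (f zero)
... | true = cong suc (length-filter-tabulate b (f ∘ suc))
... | false = length-filter-tabulate b (f ∘ suc)

length-filter-filter : ∀ {A : Set} {P : A → Set} (P? : Decidable P) (b : A → Bool) xs →
  length (filter (λ x → T? (b x)) (filter P? xs)) ≡ length (filter (λ x → T? (does (P? x) ∧ b x)) xs)
length-filter-filter P? b [] = refl
length-filter-filter P? b (x ∷ xs) with does (P? x)
... | false = length-filter-filter P? b xs
... | true with b x
... | true = cong suc (length-filter-filter P? b xs)
... | false = length-filter-filter P? b xs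

length-concatMap-tabulate : ∀ {A B : Set} {n} (g : A → List B) (f : Fin n → A) →
  length (concatMap g (tabulate f)) ≡ sum (λ i → length (g (f i)))
length-concatMap-tabulate {n = zero} g f = refl
length-concatMap-tabulate {n = suc n} g f =
  trans (length-++ (g (f zero))) (cong (length (g (f zero)) +_) (length-concatMap-tabulate g (f ∘ suc)))

module _ {C : Set} {n : ℕ} (G : ColouredGraph C n) where

  degree≡∑ : ∀ v → degree G v ≡ sum (λ w → 𝟙 (Adj G v w))
  degree≡∑ v = length-filter-tabulate (Adj G v) id

  edgeCount≡∑ : edgeCount G ≡ sum (λ u → sum (λ w → 𝟙 (does (u <ᶠ? w) ∧ Adj G u w)))
  edgeCount≡∑ = trans (length-concatMap-tabulate forwardNeighbours id) (sum-cong-≗ (λ u →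
    trans (length-filter-filter (u <ᶠ?_) (Adj G u) (allFin n))
          (length-filter-tabulate (λ w → does (u <ᶠ? w) ∧ Adj G u w) id)))
    where
    forwardNeighbours : Fin n → List (Fin n)
    forwardNeighbours u = filter (λ w → T? (Adj G u w)) (filter (u <ᶠ?_) (allFin n))

  𝟙-Adj-split : ∀ u w → 𝟙 (Adj G u w) ≡ 𝟙 (does (u <ᶠ? w) ∧ Adj G u w) + 𝟙 (does (w <ᶠ? u) ∧ Adj G w u)
  𝟙-Adj-split u w with u <ᶠ? w | w <ᶠ? u
  ... | yes u<w | yes w<u = ⊥-elim (<-asym u<w w<u)
  ... | yes u<w | no w≮u rewrite dec-true (u <ᶠ? w) u<w | dec-false (w <ᶠ? u) w≮u = sym (+-identityʳ _)
  ... | no u≮w | yes w<u rewrite dec-false (u <ᶠ? w) u≮w | dec-true (w <ᶠ? u) w<u =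
    cong (λ c → 𝟙 (is-just c)) (symmetric G u w)
  ... | no u≮w | no w≮u with toℕ-injective (≤-antisym (≮⇒≥ w≮u) (≮⇒≥ u≮w))
  ... | refl rewrite dec-false (u <ᶠ? u) u≮w = cong (λ c → 𝟙 (is-just c)) (loopless G u)

  ∑-degree : sum (degree G) ≡ 2 * edgeCount G
  ∑-degree = begin
    sum (degree G)
      ≡⟨ sum-cong-≗ (λ u → trans (degree≡∑ u) (sum-cong-≗ (𝟙-Adj-split u))) ⟩
    sum (λ u → sum (λ w → E u w + E w u))
      ≡⟨ sum-cong-≗ (λ u → ∑-distrib-+ (E u) (λ w → E w u)) ⟩
    sum (λ u → sum (E u) + sum (λ w → E w u))
      ≡⟨ ∑-distrib-+ (sum ∘ E) (λ u → sum (λ w → E w u)) ⟩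
    sum (sum ∘ E) + sum (λ u → sum (λ w → E w u))
      ≡⟨ cong (sum (sum ∘ E) +_) (∑-comm (λ u w → E w u)) ⟩
    sum (sum ∘ E) + sum (sum ∘ E)
      ≡⟨ sym (cong₂ _+_ edgeCount≡∑ (trans (+-identityʳ _) edgeCount≡∑)) ⟩
    2 * edgeCount G ∎
    where
    open ≡-Reasoning
    E : Fin n → Fin n → ℕ
    E u w = 𝟙 (does (u <ᶠ? w) ∧ Adj G u w)

module Splitting {C : Set} {n : ℕ} (G : ColouredGraph C n) (h : ℕ) .{{_ : NonZero h}}
                 (h≤degree : ∀ v → h ≤ degree G v) where

  copies : Fin n → ℕ
  copies v = degree G v / h

  copies-positive : ∀ v → 1 ≤ copies v
  copies-positive v = m≥n⇒m/n>0 (h≤degree v)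

  lastCopy : Fin n → ℕ
  lastCopy v = pred (copies v)

  suc-lastCopy : ∀ v → suc (lastCopy v) ≡ copies v
  suc-lastCopy v = suc-pred (copies v) {{>-nonZero (copies-positive v)}}

  toℕ≤lastCopy : ∀ v (j : Fin (copies v)) → toℕ j ≤ lastCopy v
  toℕ≤lastCopy v j = ≤-pred (subst (toℕ j <_) (sym (suc-lastCopy v)) (toℕ<n j))

  degree≡blocks : ∀ v → degree G v ≡ lastCopy v * h + (h + degree G v % h)
  degree≡blocks v = begin
    d ≡⟨ m≡m%n+[m/n]*n d h ⟩
    d % h + copies v * h ≡⟨ cong (λ c → d % h + c * h) (sym (suc-lastCopy v)) ⟩
    d % h + (h + lastCopy v * h) ≡⟨ +-comm (d % h) _ ⟩
    h + lastCopy v * h + d % h ≡⟨ cong (_+ d % h) (+-comm h _) ⟩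
    lastCopy v * h + h + d % h ≡⟨ +-assoc (lastCopy v * h) h _ ⟩
    lastCopy v * h + (h + d % h) ∎
    where
    open ≡-Reasoning
    d = degree G v

  Copy : Set
  Copy = Σ (Fin n) (Fin ∘ copies)

  copyFor : Fin n → Fin n → ℕ
  copyFor v w = block h (lastCopy v) (rank (Adj G v) w)

  copyFor<copies : ∀ v w → copyFor v w < copies v
  copyFor<copies v w = subst (copyFor v w <_) (suc-lastCopy v) (s≤s (block-≤ h (lastCopy v) _))

  linked : Copy → Copy → Bool
  linked (v , j) (w , k) = (copyFor v w ≡ᵇ toℕ j) ∧ (copyFor w v ≡ᵇ toℕ k)

  splitColour : Copy → Copy → Maybe C
  splitColour x y = if linked x y then colour G (proj₁ x) (proj₁ y) else nothing

  split : ColouredGraph C (sum copies)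
  split = record
    { colour = λ x y → splitColour (unpair copies x) (unpair copies y)
    ; symmetric = λ x y → symmetric′ (unpair copies x) (unpair copies y)
    ; loopless = λ x → loopless′ (unpair copies x)
    }
    where
    loopless′ : ∀ p → splitColour p p ≡ nothing
    loopless′ p = trans (cong (if linked p p then_else nothing) (loopless G (proj₁ p))) (if-eta (linked p p))
    symmetric′ : ∀ p q → splitColour p q ≡ splitColour q p
    symmetric′ (v , j) (w , k) =
      cong₂ (if_then_else nothing) (∧-comm (copyFor v w ≡ᵇ toℕ j) _) (symmetric G v w)

  project : Fin (sum copies) → Fin n
  project = proj₁ ∘ unpair copies

  project-hom : ColourPreservingHom split G project
  project-hom x y c eq = proj₂ (if-nothing≡just (linked (unpair copies x) (unpair copies y)) eq)

  split-proper : Proper G → Proper split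
  split-proper proper x y z c xy≡c xz≡c = unpair-injective copies
    (same-copy (unpair copies y) (unpair copies z) w≡w′ (copyFor≡ _ xy≡c) (copyFor≡ _ xz≡c))
    where
    v = project x
    j = proj₂ (unpair copies x)
    w≡w′ : project y ≡ project z
    w≡w′ = proper v (project y) (project z) c (project-hom x y c xy≡c) (project-hom x z c xz≡c)
    copyFor≡ : ∀ p → splitColour (v , j) p ≡ just c → copyFor (proj₁ p) v ≡ toℕ (proj₂ p)
    copyFor≡ (w , k) eq = ≡ᵇ⇒≡ _ _ (proj₂ (Equivalence.to T-∧ (proj₁ (if-nothing≡just (linked (v , j) (w , k)) eq))))
    same-copy : ∀ p q → proj₁ p ≡ proj₁ q → copyFor (proj₁ p) v ≡ toℕ (proj₂ p) → copyFor (proj₁ q) v ≡ toℕ (proj₂ q) → p ≡ q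
    same-copy (w , k) (.w , k′) refl k≡ k′≡ = cong (w ,_) (toℕ-injective (trans (sym k≡) k′≡))

  copyDegree : Copy → ℕ
  copyDegree (v , j) = blockSize h (lastCopy v) (toℕ j) (degree G v)

  degree-split : ∀ x → degree split x ≡ copyDegree (unpair copies x)
  degree-split x = trans (degree≡∑ split x) (∑-linked (unpair copies x))
    where
    ∑-linked : ∀ p → sum (λ y → 𝟙 (is-just (splitColour p (unpair copies y)))) ≡ copyDegree p
    ∑-linked (v , j) = begin
      sum (λ y → 𝟙 (is-just (splitColour (v , j) (unpair copies y))))
        ≡⟨ ∑-unpair copies (λ q → 𝟙 (is-just (splitColour (v , j) q))) ⟩
      sum (λ w → sum (λ k → 𝟙 (is-just (splitColour (v , j) (w , k)))))
        ≡⟨ sum-cong-≗ (λ w → sum-cong-≗ {copies w} (λ k → 𝟙-is-just-if-∧ (copyFor v w ≡ᵇ toℕ j) (copyFor w v ≡ᵇ toℕ k) (colour G v w))) ⟩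
      sum (λ w → sum (λ (k : Fin (copies w)) → 𝟙 (copyFor w v ≡ᵇ toℕ k) * neighbourInCopy w))
        ≡⟨ sum-cong-≗ (λ w → sym (*-distribʳ-sum {copies w} (neighbourInCopy w) (λ k → 𝟙 (copyFor w v ≡ᵇ toℕ k)))) ⟩
      sum (λ w → sum (λ (k : Fin (copies w)) → 𝟙 (copyFor w v ≡ᵇ toℕ k)) * neighbourInCopy w)
        ≡⟨ sum-cong-≗ (λ w → trans (cong (_* neighbourInCopy w) (∑-𝟙-≡ᵇ-toℕ (copyFor w v) (copyFor<copies w v))) (*-identityˡ _)) ⟩
      sum neighbourInCopy
        ≡⟨ sum-cong-≗ (λ w → 𝟙-∧ (Adj G v w) _) ⟩
      sum (λ w → 𝟙 (Adj G v w) * inBlock (rank (Adj G v) w))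
        ≡⟨ ∑-rank (Adj G v) inBlock ⟩
      sumBelow (sum (λ w → 𝟙 (Adj G v w))) inBlock
        ≡⟨ cong (λ d → sumBelow d inBlock) (sym (degree≡∑ G v)) ⟩
      copyDegree (v , j) ∎
      where
      open ≡-Reasoning
      neighbourInCopy : Fin n → ℕ
      neighbourInCopy w = 𝟙 (Adj G v w ∧ (copyFor v w ≡ᵇ toℕ j))
      inBlock : ℕ → ℕ
      inBlock r = 𝟙 (block h (lastCopy v) r ≡ᵇ toℕ j)

  copyDegree-bounds : ∀ p → h ≤ copyDegree p × copyDegree p < 2 * h
  copyDegree-bounds (v , j) = subst (h ≤_) (sym size≡) lower , (begin-strict
    copyDegree (v , j) ≡⟨ size≡ ⟩
    size               ≤⟨ upper ⟩
    h + r              <⟨ +-monoʳ-< h (m%n<n (degree G v) h) ⟩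
    h + h              ≡⟨ cong (h +_) (sym (+-identityʳ h)) ⟩
    2 * h              ∎)
    where
    open ≤-Reasoning
    r = degree G v % h
    size = blockSize h (lastCopy v) (toℕ j) (lastCopy v * h + (h + r))
    size≡ : copyDegree (v , j) ≡ size
    size≡ = cong (blockSize h (lastCopy v) (toℕ j)) (degree≡blocks v)
    lower = proj₁ (blockSize-bounds h r (lastCopy v) (toℕ j) (toℕ≤lastCopy v j))
    upper = proj₂ (blockSize-bounds h r (lastCopy v) (toℕ j) (toℕ≤lastCopy v j))

  n≤∑copies : n ≤ sum copies
  n≤∑copies = n≤∑-positive copies copies-positive

  ∑copies*h≤∑degree : sum copies * h ≤ sum (degree G)
  ∑copies*h≤∑degree = subst (_≤ sum (degree G)) (sym (*-distribʳ-sum h copies)) (∑-mono-≤ (λ v → m/n*n≤m (degree G v) h))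


  ∑copies*h≤2*edgeCount : sum copies * h ≤ 2 * edgeCount G
  ∑copies*h≤2*edgeCount = subst (sum copies * h ≤_) (∑-degree G) ∑copies*h≤∑degree

  degree-split-bounds : ∀ x → h ≤ degree split x × degree split x < 2 * h
  degree-split-bounds x rewrite degree-split x = copyDegree-bounds (unpair copies x)

  ∑copies*δ≤4*edgeCount : ∀ {δ} → δ ≤ 2 * h → sum copies * δ ≤ 4 * edgeCount G
  ∑copies*δ≤4*edgeCount {δ} δ≤2h = begin
    m * δ                 ≤⟨ *-monoʳ-≤ m δ≤2h ⟩
    m * (2 * h)           ≡⟨ *-comm m (2 * h) ⟩
    2 * h * m             ≡⟨ *-assoc 2 h m ⟩
    2 * (h * m)           ≡⟨ cong (2 *_) (*-comm h m) ⟩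
    2 * (m * h)           ≤⟨ *-monoʳ-≤ 2 ∑copies*h≤2*edgeCount ⟩
    2 * (2 * edgeCount G) ≡⟨ sym (*-assoc 2 2 (edgeCount G)) ⟩
    4 * edgeCount G       ∎
    where
    open ≤-Reasoning
    m = sum copies

  degree-split-within : ∀ {δ} → δ ≤ 2 * h → 2 * h ≤ suc δ →
    ∀ x → δ ≤ 2 * degree split x × degree split x ≤ δ
  degree-split-within δ≤2h 2h≤1+δ x =
    ≤-trans δ≤2h (*-monoʳ-≤ 2 (proj₁ (degree-split-bounds x))) ,
    ≤-pred (≤-trans (proj₂ (degree-split-bounds x)) 2h≤1+δ)

δ≤2⌈δ/2⌉ : ∀ δ → δ ≤ 2 * ⌈ δ /2⌉
δ≤2⌈δ/2⌉ δ = begin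
  δ                     ≡⟨ sym (⌊n/2⌋+⌈n/2⌉≡n δ) ⟩
  ⌊ δ /2⌋ + ⌈ δ /2⌉      ≤⟨ +-monoˡ-≤ ⌈ δ /2⌉ (⌊n/2⌋≤⌈n/2⌉ δ) ⟩
  ⌈ δ /2⌉ + ⌈ δ /2⌉      ≡⟨ cong (⌈ δ /2⌉ +_) (sym (+-identityʳ ⌈ δ /2⌉)) ⟩
  2 * ⌈ δ /2⌉ ∎
  where open ≤-Reasoning

2⌈δ/2⌉≤1+δ : ∀ δ → 2 * ⌈ δ /2⌉ ≤ suc δ
2⌈δ/2⌉≤1+δ δ = begin
  ⌈ δ /2⌉ + (⌈ δ /2⌉ + 0) ≡⟨ cong (⌈ δ /2⌉ +_) (+-identityʳ ⌈ δ /2⌉) ⟩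
  ⌈ δ /2⌉ + ⌈ δ /2⌉      ≤⟨ +-monoˡ-≤ ⌈ δ /2⌉ (⌊n/2⌋-mono (n≤1+n (suc δ))) ⟩
  suc ⌊ δ /2⌋ + ⌈ δ /2⌉  ≡⟨ cong suc (⌊n/2⌋+⌈n/2⌉≡n δ) ⟩
  suc δ ∎
  where open ≤-Reasoning

lemma3p1 : {C : Set} {n : ℕ} (G : ColouredGraph C n) → Proper G →
    (δ : ℕ) → IsMinDegree G δ → 1 ≤ δ →
    Σ ℕ λ m → Σ (ColouredGraph C m) λ G' →
      Proper G'
      × n ≤ m
      × m * δ ≤ 4 * edgeCount G
      × (∀ v → δ ≤ 2 * degree G' v × degree G' v ≤ δ)
      × Σ (Fin m → Fin n) (λ ψ → ColourPreservingHom G' G ψ)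
lemma3p1 G proper δ@(suc _) (δ≤degree , _) _ =
  sum copies , split , split-proper proper , n≤∑copies ,
  ∑copies*δ≤4*edgeCount (δ≤2⌈δ/2⌉ δ) , degree-split-within (δ≤2⌈δ/2⌉ δ) (2⌈δ/2⌉≤1+δ δ) ,
  project , project-hom
  where open Splitting G ⌈ δ /2⌉ (λ v → ≤-trans (⌈n/2⌉≤n δ) (δ≤degree v))
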